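{- Let $(D,r)$ be a connected rooted digraph and let $D'$ be the rooted digraph obtained from $D$ by contracting a cut-edge. Then $\mathrm{maxleaf}(D)\ge\mathrm{maxleaf}(D')$.
   Context: A rooted digraph $(D,r)$ is a finite digraph without loops or parallel arcs with a root $r$ of in-degree $0$; it is connected if every vertex is reachable from $r$. A cut-edge is an arc $e$ such that some vertex is unreachable from $r$ in $D-e$. Contracting an arc $(a,b)$ means identifying $a,b$ into a new vertex, replacing $a,b$ by it in all arcs, and deleting loops and parallel arcs; the root of $D'$ is $r$, or the new vertex if $r\in\{a,b\}$. An outbranching rooted at the root is a spanning subgraph whose underlying undirected graph is a tree with arcs oriented away from the root; its leaves are vertices of out-degree $0$; $\mathrm{maxleaf}$ is the maximum number of leaves of such an outbranching. -}

module Defs where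

open import Data.Nat using (ℕ; suc; _≤_)
open import Data.Fin using (Fin; punchOut; _≟_)
open import Data.Bool using (Bool; true; false; not; T)
open import Data.List using (List; length; filterᵇ; map; foldr; allFin)
open import Data.Bool using (_∧_)
open import Data.Product using (Σ; ∃; ∃₂; _×_; _,_)
open import Relation.Binary.PropositionalEquality using (_≡_; _≢_; refl; sym; subst)
open import Relation.Nullary using (¬_; yes; no)

-- A digraph on the vertex set Fin n is given by its arc relation.
-- (A relation: no parallel arcs by construction.)
Arcs : ℕ → Set₁
Arcs n = Fin n → Fin n → Set

Loopless : ∀ {n} → Arcs n → Set
Loopless A = ∀ v → ¬ A v v

data Reach {n} (A : Arcs n) (x : Fin n) : Fin n → Set where
  here : Reach A x x
  step : ∀ {y z} → Reach A x y → A y z → Reach A x z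

Rooted : ∀ {n} → Arcs n → Fin n → Set
Rooted A r = Loopless A × (∀ u → ¬ A u r)

Connected : ∀ {n} → Arcs n → Fin n → Set
Connected A r = ∀ v → Reach A r v

deleteArc : ∀ {n} → Arcs n → Fin n → Fin n → Arcs n
deleteArc A a b u w = A u w × ¬ (u ≡ a × w ≡ b)

CutEdge : ∀ {n} → Arcs n → Fin n → Fin n → Fin n → Set
CutEdge A r a b = A a b × ∃ λ v → ¬ Reach (deleteArc A a b) r v

-- The vertex set of D' is
-- Fin n, obtained from Fin (suc n) by deleting b (punchOut) and letting the
-- image of a be the new, identified vertex.  q is the identification map.
contractMap : ∀ {n} (a b : Fin (suc n)) → a ≢ b → Fin (suc n) → Fin n
contractMap a b a≢b v with v ≟ b
... | yes _ = punchOut {i = b} {j = a} (λ eq → a≢b (sym eq))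
... | no v≢b = punchOut {i = b} {j = v} (λ eq → v≢b (sym eq))

contractArcs : ∀ {n} (A : Arcs (suc n)) (a b : Fin (suc n)) → a ≢ b → Arcs n
contractArcs A a b a≢b x y =
  x ≢ y × ∃₂ λ u w → A u w × contractMap a b a≢b u ≡ x × contractMap a b a≢b w ≡ y

-- root of D': r if r ∉ {a,b}, the new vertex otherwise (both given by q r)
contractRoot : ∀ {n} (a b : Fin (suc n)) → a ≢ b → Fin (suc n) → Fin n
contractRoot a b a≢b r = contractMap a b a≢b r

arc-distinct : ∀ {n} {A : Arcs n} → Loopless A → ∀ {a b} → A a b → a ≢ b
arc-distinct {A = A} nl {a} {b} e refl = nl a e

Sel : ℕ → Set
Sel n = Fin n → Fin n → Bool

IsOutbranching : ∀ {n} → Arcs n → Fin n → Sel n → Set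
IsOutbranching A r B =
    (∀ u w → T (B u w) → A u w)
  × (∀ u → ¬ T (B u r))
  × (∀ v → v ≢ r → ∃ λ u → T (B u v) × (∀ u′ → T (B u′ v) → u′ ≡ u))
  × (∀ v → Reach (λ u w → T (B u w)) r v)

isLeaf : ∀ {n} → Sel n → Fin n → Bool
isLeaf {n} B v = foldr _∧_ true (map (λ w → not (B v w)) (allFin n))

leaves : ∀ {n} → Sel n → ℕ
leaves {n} B = length (filterᵇ (isLeaf B) (allFin n))

IsMaxleaf : ∀ {n} → Arcs n → Fin n → ℕ → Set
IsMaxleaf A r m =
  (∃ λ B → IsOutbranching A r B × leaves B ≡ m)
  × (∀ B → IsOutbranching A r B → leaves B ≤ m)

module Submission where

-- Let e = (a,b) be a cut-edge of the connected rooted digraph (D,r), let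
-- q : V(D) → V(D') be the contraction map and let B' be an outbranching of

-- D' rooted at r' = q r.  We lift B' to an outbranching B of D by choosing a
-- parent for every non-root vertex: b gets the parent a, and any other v
-- gets the tail of an arc of D that projects onto the B'-arc entering q v.

-- The delicate point is that the chosen arc really ends in v and not in b.

-- Since e is a cut-edge, b is unreachable from r in D − e, so only a can
-- enter b from the part of D reachable in D − e; and the tail of the lifted
-- arc lies in that part, because the B'-path from r' to it avoids q a (a
-- vertex of an outbranching never reaches its own parent).

-- Every B-arc other than e projects onto a B'-arc, so a section of q
-- sending q a to b maps leaves of B' injectively to leaves of B.
--

open import Defs
open import Data.Nat using (ℕ; zero; suc; _≤_; _+_; z≤n)
open import Data.Nat.Properties using (≤-refl; ≤-trans; +-mono-≤; +-comm; +-assoc; module ≤-Reasoning)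
open import Data.Fin using (Fin; zero; suc; punchIn; punchOut; _≟_)
open import Data.Fin.Properties
  using (0≢1+n; suc-injective; punchInᵢ≢i; punchIn-punchOut; punchOut-punchIn; punchOut-cong; punchOut-injective)
open import Data.Bool using (Bool; true; false; not; T; _∧_)
open import Data.List using (length; filterᵇ; tabulate; allFin)
open import Data.List.Relation.Unary.All.Properties using (all⁺; all⁻; tabulate⁺; tabulate⁻)
open import Data.Unit using (tt)
open import Data.Empty using (⊥; ⊥-elim)
open import Data.Sum using (_⊎_; inj₁; inj₂)
open import Data.Product using (Σ-syntax; _×_; _,_; proj₁; proj₂)
open import Relation.Binary.PropositionalEquality
open import Relation.Nullary using (¬_; Dec; yes; no)
open import Relation.Nullary.Decidable using (⌊_⌋)
open import Function using (_∘_; id)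
open import Function.Definitions using (Injective)

b2n : Bool → ℕ
b2n true = 1
b2n false = 0

count : ∀ {n} → (Fin n → Bool) → ℕ
count {zero} p = 0
count {suc n} p = b2n (p zero) + count (p ∘ suc)

length-filter-tabulate : ∀ {X : Set} (p : X → Bool) {n} (g : Fin n → X) →
  length (filterᵇ p (tabulate g)) ≡ count (p ∘ g)
length-filter-tabulate p {zero} g = refl
length-filter-tabulate p {suc n} g with p (g zero)
... | true = cong suc (length-filter-tabulate p (g ∘ suc))
... | false = length-filter-tabulate p (g ∘ suc)

leaves≡count : ∀ {n} (B : Sel n) → leaves B ≡ count (isLeaf B)
leaves≡count B = length-filter-tabulate (isLeaf B) id

count-punchIn : ∀ {n} (f : Fin (suc n) → Bool) (i : Fin (suc n)) →
  count f ≡ b2n (f i) + count (f ∘ punchIn i)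
count-punchIn f zero = refl
count-punchIn {suc n} f (suc i) = begin
    x + count (f ∘ suc)
  ≡⟨ cong (x +_) (count-punchIn (f ∘ suc) i) ⟩
    x + (y + z)
  ≡⟨ sym (+-assoc x y z) ⟩
    (x + y) + z
  ≡⟨ cong (_+ z) (+-comm x y) ⟩
    (y + x) + z
  ≡⟨ +-assoc y x z ⟩
    y + (x + z)
  ∎
  where
    open ≡-Reasoning
    x = b2n (f zero)
    y = b2n (f (suc i))
    z = count (f ∘ suc ∘ punchIn i)

b2n-mono : ∀ {x y} → (T x → T y) → b2n x ≤ b2n y
b2n-mono {true} {true} _ = ≤-refl
b2n-mono {true} {false} x⇒y = ⊥-elim (x⇒y tt)
b2n-mono {false} _ = z≤n

-- Induction on the domain: the image of zero is removed from the codomain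
-- by punchOut, which keeps the remaining map injective.
count-injection : ∀ {m k} (g : Fin m → Bool) (f : Fin k → Bool) (s : Fin m → Fin k) →
  Injective _≡_ _≡_ s → (∀ i → T (g i) → T (f (s i))) → count g ≤ count f
count-injection {zero} g f s s-inj g⇒f = z≤n
count-injection {suc m} {zero} g f s s-inj g⇒f with s zero
... | ()
count-injection {suc m} {suc k} g f s s-inj g⇒f = begin
    b2n (g zero) + count (g ∘ suc)
  ≤⟨ +-mono-≤ (b2n-mono (g⇒f zero))
        (count-injection (g ∘ suc) (f ∘ punchIn (s zero)) s′ s′-inj g⇒f′) ⟩
    b2n (f (s zero)) + count (f ∘ punchIn (s zero))
  ≡⟨ sym (count-punchIn f (s zero)) ⟩
    count f
  ∎
  where
    open ≤-Reasoning
    s₀≢ : ∀ i → s zero ≢ s (suc i)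
    s₀≢ i e = 0≢1+n (s-inj e)
    s′ : Fin m → Fin k
    s′ i = punchOut (s₀≢ i)
    s′-inj : Injective _≡_ _≡_ s′
    s′-inj {i} {j} e = suc-injective (s-inj (punchOut-injective (s₀≢ i) (s₀≢ j) e))
    g⇒f′ : ∀ i → T (g (suc i)) → T (f (punchIn (s zero) (s′ i)))
    g⇒f′ i t = subst (T ∘ f) (sym (punchIn-punchOut (s₀≢ i))) (g⇒f (suc i) t)

T-not⇒¬T : ∀ {x} → T (not x) → ¬ T x
T-not⇒¬T {false} _ ()

¬T⇒T-not : ∀ {x} → ¬ T x → T (not x)
¬T⇒T-not {true} ¬t = ¬t tt
¬T⇒T-not {false} _ = tt

leaf⇒no-out-arc : ∀ {n} (B : Sel n) {v} → T (isLeaf B v) → ∀ w → ¬ T (B v w)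
leaf⇒no-out-arc B {v} leaf w =
  T-not⇒¬T (tabulate⁻ (all⁺ (λ w → not (B v w)) (allFin _) leaf) w)

no-out-arc⇒leaf : ∀ {n} (B : Sel n) {v} → (∀ w → ¬ T (B v w)) → T (isLeaf B v)
no-out-arc⇒leaf B {v} noArc = all⁻ (λ w → not (B v w)) (tabulate⁺ (λ w → ¬T⇒T-not (noArc w)))

reach-trans : ∀ {n} {A : Arcs n} {x y z} → Reach A x y → Reach A y z → Reach A x z
reach-trans p here = p
reach-trans p (step q e) = step (reach-trans p q) e

arcsOf : ∀ {n} → Sel n → Arcs n
arcsOf B u w = T (B u w)

-- A walk from r in D either avoids the arc (a,b), or its part after the
-- last use of (a,b) is a walk from b in D − (a,b).
split-walk : ∀ {n} {A : Arcs n} {r a b v} → Reach A r v →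
  Reach (deleteArc A a b) r v ⊎ Reach (deleteArc A a b) b v
split-walk here = inj₁ here
split-walk {a = a} {b} (step {y} {z} p e) with split-walk p | y ≟ a | z ≟ b
... | _ | yes refl | yes refl = inj₂ here
... | inj₁ s | no y≢a | _ = inj₁ (step s (e , λ { (y≡a , _) → y≢a y≡a }))
... | inj₁ s | yes _ | no z≢b = inj₁ (step s (e , λ { (_ , z≡b) → z≢b z≡b }))
... | inj₂ s | no y≢a | _ = inj₂ (step s (e , λ { (y≡a , _) → y≢a y≡a }))
... | inj₂ s | yes _ | no z≢b = inj₂ (step s (e , λ { (_ , z≡b) → z≢b z≡b }))

module CutEdgeFacts {n} (A : Arcs n) (r a b : Fin n)
    (conn : Connected A r) (cut : CutEdge A r a b) where

  head-unreachable : ¬ Reach (deleteArc A a b) r b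
  head-unreachable r⇝b with split-walk (conn (proj₁ (proj₂ cut)))
  ... | inj₁ r⇝v = proj₂ (proj₂ cut) r⇝v
  ... | inj₂ b⇝v = proj₂ (proj₂ cut) (reach-trans r⇝b b⇝v)

  only-tail-enters-head : ∀ {u} → Reach (deleteArc A a b) r u → A u b → u ≡ a
  only-tail-enters-head {u} r⇝u Aub with u ≟ a
  ... | yes u≡a = u≡a
  ... | no u≢a = ⊥-elim (head-unreachable (step r⇝u (Aub , λ { (u≡a , _) → u≢a u≡a })))

module OutbranchingFacts {n} (A : Arcs n) (r : Fin n) (B : Sel n)
    (ob : IsOutbranching A r B) where

  no-arc-into-root : ∀ u → ¬ T (B u r)
  no-arc-into-root = proj₁ (proj₂ ob)

  reaches : ∀ v → Reach (arcsOf B) r v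
  reaches = proj₂ (proj₂ (proj₂ ob))

  parent-unique : ∀ {x₁ x₂ y} → y ≢ r → T (B x₁ y) → T (B x₂ y) → x₁ ≡ x₂
  parent-unique {x₁} {x₂} {y} y≢r e₁ e₂ =
    let unique = proj₂ (proj₂ (proj₁ (proj₂ (proj₂ ob)) y y≢r)) in
    trans (unique x₁ e₁) (sym (unique x₂ e₂))

  -- A non-root vertex c never reaches its parent p.  Assuming c ⇝ p, one
  -- shows by induction along the walk from r to z that c ⇝ z is impossible
  -- (the last arc into z ≢ r is its unique parent arc); yet c ⇝ c.
  no-reach-parent : ∀ {c p} → c ≢ r → T (B p c) → ¬ Reach (arcsOf B) c p
  no-reach-parent {c} {p} c≢r Bpc c⇝p = reaches-nothing (reaches c) here
    where
      reaches-nothing : ∀ {z} → Reach (arcsOf B) r z → ¬ Reach (arcsOf B) c z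
      reaches-nothing here here = c≢r refl
      reaches-nothing here (step {y} _ e) = no-arc-into-root y e
      reaches-nothing (step r⇝x Bxc) here =
        reaches-nothing r⇝x (subst (Reach (arcsOf B) c) (parent-unique c≢r Bpc Bxc) c⇝p)
      reaches-nothing (step {x} r⇝x Bxz) (step c⇝x′ Bx′z) =
        reaches-nothing r⇝x
          (subst (Reach (arcsOf B) c)
                 (parent-unique (λ z≡r → no-arc-into-root x (subst (arcsOf B x) z≡r Bxz)) Bx′z Bxz)
                 c⇝x′)

module ParentTree {n} (r : Fin n) (parent : Fin n → Fin n) where

  treeSel : Sel n
  treeSel u w = not ⌊ w ≟ r ⌋ ∧ ⌊ parent w ≟ u ⌋

  treeSel-sound : ∀ {u w} → T (treeSel u w) → w ≢ r × parent w ≡ u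
  treeSel-sound {u} {w} t with w ≟ r | parent w ≟ u
  ... | no w≢r | yes e = w≢r , e

  treeSel-complete : ∀ {w} → w ≢ r → T (treeSel (parent w) w)
  treeSel-complete {w} w≢r with w ≟ r | parent w ≟ parent w
  ... | yes w≡r | _ = w≢r w≡r
  ... | no _ | yes _ = tt
  ... | no _ | no ne = ne refl

  reach-from-parent : ∀ {v} → v ≢ r → Reach (arcsOf treeSel) r (parent v) → Reach (arcsOf treeSel) r v
  reach-from-parent v≢r r⇝p = step r⇝p (treeSel-complete v≢r)

  treeSel-outbranching : ∀ (A : Arcs n) → (∀ v → v ≢ r → A (parent v) v) →
    (∀ v → Reach (arcsOf treeSel) r v) → IsOutbranching A r treeSel
  treeSel-outbranching A parent-arc reach =
      (λ u w t → let w≢r , p≡u = treeSel-sound t in subst (λ x → A x w) p≡u (parent-arc w w≢r))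
    , (λ u t → proj₁ (treeSel-sound t) refl)
    , (λ v v≢r → parent v , treeSel-complete v≢r , λ u t → sym (proj₂ (treeSel-sound t)))
    , reach

module Contraction {n} (a b : Fin (suc n)) (a≢b : a ≢ b) where

  q : Fin (suc n) → Fin n
  q = contractMap a b a≢b

  q-away-from-b : ∀ {v} (v≢b : v ≢ b) → q v ≡ punchOut (v≢b ∘ sym)
  q-away-from-b {v} v≢b with v ≟ b
  ... | yes v≡b = ⊥-elim (v≢b v≡b)
  ... | no _ = punchOut-cong b refl

  q-b : q b ≡ q a
  q-b with b ≟ b
  ... | yes _ = trans (punchOut-cong b refl) (sym (q-away-from-b a≢b))
  ... | no b≢b = ⊥-elim (b≢b refl)

  q-punchIn : ∀ y → q (punchIn b y) ≡ y
  q-punchIn y = trans (q-away-from-b (punchInᵢ≢i b y)) (trans (punchOut-cong b refl) (punchOut-punchIn b))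

  q-injective : ∀ {u v} → u ≢ b → v ≢ b → q u ≡ q v → u ≡ v
  q-injective {u} {v} u≢b v≢b e = begin
      u                  ≡⟨ sym (punchIn-punchOut (u≢b ∘ sym)) ⟩
      punchIn b (q′ u≢b) ≡⟨ cong (punchIn b) (trans (sym (q-away-from-b u≢b)) (trans e (q-away-from-b v≢b))) ⟩
      punchIn b (q′ v≢b) ≡⟨ punchIn-punchOut (v≢b ∘ sym) ⟩
      v                  ∎
    where
      open ≡-Reasoning
      q′ : ∀ {w} → w ≢ b → Fin n
      q′ w≢b = punchOut (w≢b ∘ sym)

  q≢qa⇒≢b : ∀ {v} → q v ≢ q a → v ≢ b
  q≢qa⇒≢b qv≢qa v≡b = qv≢qa (trans (cong q v≡b) q-b)

  q-fibre : ∀ {w v} → v ≢ b → q w ≡ q v → w ≡ v ⊎ w ≡ b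
  q-fibre {w} {v} v≢b qw≡qv = by-cases (w ≟ b)
    where
      by-cases : Dec (w ≡ b) → w ≡ v ⊎ w ≡ b
      by-cases (yes w≡b) = inj₂ w≡b
      by-cases (no w≢b) = inj₁ (q-injective w≢b v≢b qw≡qv)

  lift : Fin n → Fin (suc n)
  lift y with y ≟ q a
  ... | yes _ = b
  ... | no _ = punchIn b y

  q-lift : ∀ y → q (lift y) ≡ y
  q-lift y with y ≟ q a
  ... | yes y≡qa = trans q-b (sym y≡qa)
  ... | no _ = q-punchIn y

  lift-injective : Injective _≡_ _≡_ lift
  lift-injective {x} {y} e = trans (sym (q-lift x)) (trans (cong q e) (q-lift y))

  lift≢a : ∀ y → lift y ≢ a
  lift≢a y lift≡a with y ≟ q a
  ... | yes _ = a≢b (sym lift≡a)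
  ... | no y≢qa = y≢qa (trans (sym (q-punchIn y)) (cong q lift≡a))

module Lift {n} (A : Arcs (suc n)) (r a b : Fin (suc n))
    (rooted : Rooted A r) (conn : Connected A r) (cut : CutEdge A r a b)
    (B′ : Sel n)
    (ob′ : IsOutbranching (contractArcs A a b (arc-distinct (proj₁ rooted) (proj₁ cut)))
                          (contractRoot a b (arc-distinct (proj₁ rooted) (proj₁ cut)) r) B′) where

  a≢b : a ≢ b
  a≢b = arc-distinct (proj₁ rooted) (proj₁ cut)

  open Contraction a b a≢b
  open CutEdgeFacts A r a b conn cut
  open OutbranchingFacts _ _ B′ ob′
    renaming (reaches to reaches′; no-arc-into-root to no-arc-into-root′)

  r′ : Fin n
  r′ = q r

  D−e : Arcs (suc n)
  D−e = deleteArc A a b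

  -- the root has in-degree 0, so it is not the head b of a cut-edge, and
  -- it is the only preimage of r' other than possibly b
  r≢b : r ≢ b
  r≢b r≡b = proj₂ rooted a (subst (A a) (sym r≡b) (proj₁ cut))

  q-root : ∀ {v} → v ≢ b → q v ≡ r′ → v ≡ r
  q-root v≢b e = q-injective v≢b r≢b e

  arc-preimage : ∀ {x y} → T (B′ x y) →
    x ≢ y × Σ[ u ∈ Fin (suc n) ] Σ[ w ∈ Fin (suc n) ] A u w × q u ≡ x × q w ≡ y
  arc-preimage = proj₁ ob′ _ _

  walk-lift : ∀ {y} → Reach (arcsOf B′) r′ y →
    Reach (arcsOf B′) (q a) y ⊎ (∀ v → q v ≡ y → Reach D−e r v)
  walk-lift here with r′ ≟ q a
  ... | yes r′≡qa = inj₁ (subst (Reach (arcsOf B′) (q a)) (sym r′≡qa) here)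
  ... | no r′≢qa = inj₂ λ v qv≡r′ →
    let v≢b = q≢qa⇒≢b (λ qv≡qa → r′≢qa (trans (sym qv≡r′) qv≡qa))
    in subst (Reach D−e r) (sym (q-root v≢b qv≡r′)) here
  walk-lift (step {x} {y} r′⇝x Bxy) with walk-lift r′⇝x | y ≟ q a
  ... | inj₁ qa⇝x | _ = inj₁ (step qa⇝x Bxy)
  ... | inj₂ _ | yes y≡qa = inj₁ (subst (Reach (arcsOf B′) (q a)) (sym y≡qa) here)
  ... | inj₂ lifts | no y≢qa with arc-preimage Bxy
  ...   | _ , u , w , Auw , qu≡x , qw≡y = inj₂ λ v qv≡y →
    let off-b : ∀ {t} → q t ≡ y → t ≢ b
        off-b qt≡y = q≢qa⇒≢b (λ qt≡qa → y≢qa (trans (sym qt≡y) qt≡qa))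
        w≡v = q-injective (off-b qw≡y) (off-b qv≡y) (trans qw≡y (sym qv≡y))
    in step (lifts u qu≡x) (subst (A u) w≡v Auw , λ { (_ , v≡b) → off-b qv≡y v≡b })

  lift-parent-arc : ∀ y → y ≢ r′ →
    Σ[ u ∈ Fin (suc n) ] T (B′ (q u) y) × Σ[ w ∈ Fin (suc n) ] A u w × q w ≡ y
  lift-parent-arc y y≢r′ with proj₁ (proj₂ (proj₂ ob′)) y y≢r′
  ... | x , Bxy , _ with arc-preimage Bxy
  ...   | _ , u , w , Auw , qu≡x , qw≡y = u , subst (λ z → T (B′ z y)) (sym qu≡x) Bxy , w , Auw , qw≡y

  -- a non-root vertex v ≢ b takes the tail of the lifted B'-arc into q v
  -- (the value at the root is irrelevant)
  lifted-parent : Fin (suc n) → Fin (suc n)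
  lifted-parent v with q v ≟ r′
  ... | yes _ = v
  ... | no qv≢r′ = proj₁ (lift-parent-arc (q v) qv≢r′)

  lifted-parent-spec : ∀ {v} → v ≢ b → v ≢ r →
    T (B′ (q (lifted-parent v)) (q v)) × Σ[ w ∈ Fin (suc n) ] A (lifted-parent v) w × q w ≡ q v
  lifted-parent-spec {v} v≢b v≢r with q v ≟ r′
  ... | yes qv≡r′ = ⊥-elim (v≢r (q-root v≢b qv≡r′))
  ... | no qv≢r′ = proj₂ (lift-parent-arc (q v) qv≢r′)

  -- The parent map: a for b, the lifted parent otherwise.  The case split is
  -- on an explicit decision of v ≡ b, so that unfolding parent leaves q v
  -- (which itself decides v ≡ b) untouched.
  parent-by : ∀ v → Dec (v ≡ b) → Fin (suc n)
  parent-by v (yes _) = a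
  parent-by v (no _) = lifted-parent v

  parent : Fin (suc n) → Fin (suc n)
  parent v = parent-by v (v ≟ b)

  parent-b : parent b ≡ a
  parent-b with b ≟ b
  ... | yes _ = refl
  ... | no b≢b = ⊥-elim (b≢b refl)

  parent-spec : ∀ {v} → v ≢ b → v ≢ r →
    T (B′ (q (parent v)) (q v)) × Σ[ w ∈ Fin (suc n) ] A (parent v) w × q w ≡ q v
  parent-spec {v} v≢b v≢r = spec-by (v ≟ b)
    where
      spec-by : ∀ d → T (B′ (q (parent-by v d)) (q v)) × Σ[ w ∈ Fin (suc n) ] A (parent-by v d) w × q w ≡ q v
      spec-by (yes v≡b) = ⊥-elim (v≢b v≡b)
      spec-by (no _) = lifted-parent-spec v≢b v≢r

  -- The lifted arc into the identified vertex q a never ends in b: its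
  -- tail is reachable in D − e (the B'-path to it avoids q a), so the tail
  -- would be a and the B'-arc a loop.
  parent-not-into-b : ∀ {v} → v ≢ b → v ≢ r → q v ≡ q a → ¬ A (parent v) b
  parent-not-into-b {v} v≢b v≢r qv≡qa Apb with parent-spec v≢b v≢r
  ... | Bpv , _ with walk-lift (reaches′ (q (parent v)))
  ...   | inj₁ qa⇝p =
    no-reach-parent (λ qa≡r′ → v≢r (q-root v≢b (trans qv≡qa qa≡r′)))
                    (subst (arcsOf B′ (q (parent v))) qv≡qa Bpv) qa⇝p
  ...   | inj₂ lifts =
    let p≡a = only-tail-enters-head (lifts (parent v) refl) Apb
    in proj₁ (arc-preimage Bpv) (trans (cong q p≡a) (sym qv≡qa))

  -- every non-root vertex is entered from its parent by an arc of D: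
  -- for b this is the cut-edge, otherwise the lifted arc ends in v itself
  parent-arc-off-b : ∀ {v} → v ≢ b → v ≢ r → A (parent v) v
  parent-arc-off-b {v} v≢b v≢r with parent-spec v≢b v≢r
  ... | _ , w , Apw , qw≡qv with q-fibre {w} v≢b qw≡qv
  ...   | inj₁ w≡v = subst (A (parent v)) w≡v Apw
  ...   | inj₂ w≡b = ⊥-elim (parent-not-into-b v≢b v≢r
                        (trans (sym qw≡qv) (trans (cong q w≡b) q-b)) (subst (A (parent v)) w≡b Apw))

  parent-arc : ∀ v → v ≢ r → A (parent v) v
  parent-arc v v≢r = by-cases (v ≟ b)
    where
      by-cases : Dec (v ≡ b) → A (parent v) v
      by-cases (yes refl) = subst (λ u → A u v) (sym parent-b) (proj₁ cut)
      by-cases (no v≢b) = parent-arc-off-b v≢b v≢r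

  open ParentTree r parent

  B : Sel (suc n)
  B = treeSel

  B-projects : ∀ {u w} → T (B u w) → w ≢ b → T (B′ (q u) (q w))
  B-projects {u} {w} t w≢b with treeSel-sound t
  ... | w≢r , p≡u = subst (λ x → T (B′ (q x) (q w))) p≡u (proj₁ (parent-spec w≢b w≢r))

  reach-b : Reach (arcsOf B) r a → Reach (arcsOf B) r b
  reach-b r⇝a = reach-from-parent (λ b≡r → r≢b (sym b≡r)) (subst (Reach (arcsOf B) r) (sym parent-b) r⇝a)

  reach-fibre : ∀ {y} → Reach (arcsOf B′) r′ y → ∀ v → v ≢ b → q v ≡ y → Reach (arcsOf B) r v
  reach-fibre here v v≢b qv≡r′ = subst (Reach (arcsOf B) r) (sym (q-root v≢b qv≡r′)) here
  reach-fibre (step {x} r′⇝x Bxy) v v≢b refl = reach-from-parent v≢r reach-parent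
    where
      v≢r : v ≢ r
      v≢r v≡r = no-arc-into-root′ x (subst (arcsOf B′ x) (cong q v≡r) Bxy)
      qp≡x : q (parent v) ≡ x
      qp≡x = parent-unique (v≢r ∘ q-root v≢b) (proj₁ (parent-spec v≢b v≢r)) Bxy
      reach-parent : Reach (arcsOf B) r (parent v)
      reach-parent with parent v ≟ b
      ... | no p≢b = reach-fibre r′⇝x (parent v) p≢b qp≡x
      ... | yes p≡b = subst (Reach (arcsOf B) r) (sym p≡b)
          (reach-b (reach-fibre r′⇝x a a≢b (trans (sym q-b) (trans (cong q (sym p≡b)) qp≡x))))

  reach-all : ∀ v → Reach (arcsOf B) r v
  reach-all v with v ≟ b
  ... | yes refl = reach-b (reach-fibre (reaches′ (q a)) a a≢b refl)
  ... | no v≢b = reach-fibre (reaches′ (q v)) v v≢b refl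

  B-outbranching : IsOutbranching A r B
  B-outbranching = treeSel-outbranching A parent-arc reach-all

  leaf-lift : ∀ y → T (isLeaf B′ y) → T (isLeaf B (lift y))
  leaf-lift y leaf = no-out-arc⇒leaf B no-out-arc
    where
      no-out-arc : ∀ w → ¬ T (B (lift y) w)
      no-out-arc w t = by-cases (w ≟ b)
        where
          by-cases : Dec (w ≡ b) → ⊥
          by-cases (yes refl) = lift≢a y (trans (sym (proj₂ (treeSel-sound {w = b} t))) parent-b)
          by-cases (no w≢b) =
            leaf⇒no-out-arc B′ leaf (q w) (subst (λ z → T (B′ z (q w))) (q-lift y) (B-projects t w≢b))

  leaves-lift : leaves B′ ≤ leaves B
  leaves-lift = subst₂ _≤_ (sym (leaves≡count B′)) (sym (leaves≡count B))
    (count-injection (isLeaf B′) (isLeaf B) lift lift-injective leaf-lift)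

lemma18 : ∀ {n} (A : Arcs (suc n)) (r a b : Fin (suc n))
    → (rooted : Rooted A r) → Connected A r
    → (cut : CutEdge A r a b)
    → ∀ (m m′ : ℕ)
    → IsMaxleaf A r m
    → IsMaxleaf (contractArcs A a b (arc-distinct (proj₁ rooted) (proj₁ cut)))
                (contractRoot a b (arc-distinct (proj₁ rooted) (proj₁ cut)) r) m′
    → m′ ≤ m
lemma18 A r a b rooted conn cut m m′ (_ , maximal) ((B′ , ob′ , leaves≡m′) , _) =
  subst (_≤ m) leaves≡m′ (≤-trans leaves-lift (maximal B B-outbranching))
  where open Lift A r a b rooted conn cut B′ ob′
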